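{- Let $G$ be a graph and $\mathcal{W}$ an edge clique cover of $G$. If $C$ is a block of $G$, then $V(G,\mathcal{W}[C])=C$.
   Context: Graphs are finite, simple and undirected. An edge clique cover of $G$ is a collection $\mathcal{W}$ of cliques of $G$ with every edge having both endpoints in some $W\in\mathcal{W}$. For $X\subseteq V(G)$, $N(X)$ is the set of vertices outside $X$ adjacent to a vertex of $X$. A full component of $S$ is a connected component $C$ of $G\setminus S$ with $N(C)=S$; a minimal separator is a set with at least two full components. A block of $G$ is a vertex set $C$ that is a connected component of $G\setminus N(C)$ such that $N(C)$ is a minimal separator. For $X\subseteq V(G)$, $\mathcal{W}[X]=\{W\in\mathcal{W}: W\cap X\ne\emptyset\}$. For $\mathcal{W}'\subseteq\mathcal{W}$, $V(G,\mathcal{W}')=\{v\in V(G): \{W\in\mathcal{W}: v\in W\}\subseteq\mathcal{W}'\}$. -}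

module Defs where

open import Data.Nat using (ℕ)
open import Data.Bool using (Bool; true; false)
open import Data.Fin using (Fin)
open import Data.Fin.Subset using (Subset; _∈_; _∉_)
open import Data.List using (List)
import Data.List.Membership.Propositional as LM
open import Data.Product using (Σ; ∃; _×_; _,_)
open import Data.Empty using (⊥)
open import Relation.Nullary using (¬_)
open import Relation.Binary.PropositionalEquality using (_≡_; _≢_)
open import Function.Bundles using (_⇔_)

record Graph (n : ℕ) : Set where
  field
    adj     : Fin n → Fin n → Bool
    adj-sym : ∀ u v → adj u v ≡ adj v u
    adj-irr : ∀ v → adj v v ≡ false
open Graph public

Adj : ∀ {n} → Graph n → Fin n → Fin n → Set
Adj G u v = adj G u v ≡ true

VSet : ℕ → Set₁
VSet n = Fin n → Set

IsClique : ∀ {n} → Graph n → Subset n → Set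
IsClique G W = ∀ u v → u ∈ W → v ∈ W → u ≢ v → Adj G u v

IsEdgeCliqueCover : ∀ {n} → Graph n → List (Subset n) → Set
IsEdgeCliqueCover G 𝒲 =
  (∀ W → W LM.∈ 𝒲 → IsClique G W) ×
  (∀ u v → Adj G u v → ∃ λ W → W LM.∈ 𝒲 × u ∈ W × v ∈ W)

N : ∀ {n} → Graph n → Subset n → VSet n
N G X v = v ∉ X × ∃ λ u → u ∈ X × Adj G u v

data ReachIn {n} (G : Graph n) (X : Subset n) (u : Fin n) : Fin n → Set where
  here : u ∈ X → ReachIn G X u u
  step : ∀ {w v} → ReachIn G X u w → Adj G w v → v ∈ X → ReachIn G X u v

IsComponentOf : ∀ {n} → Graph n → VSet n → Subset n → Set
IsComponentOf G S C =
  (∃ λ v → v ∈ C) ×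
  (∀ v → v ∈ C → ¬ S v) ×
  (∀ u v → u ∈ C → v ∈ C → ReachIn G C u v) ×
  (∀ u v → u ∈ C → ¬ S v → Adj G u v → v ∈ C)

IsFullComponent : ∀ {n} → Graph n → VSet n → Subset n → Set
IsFullComponent G S C = IsComponentOf G S C × (∀ v → N G C v ⇔ S v)

IsMinimalSeparator : ∀ {n} → Graph n → VSet n → Set
IsMinimalSeparator {n} G S =
  Σ (Subset n) λ C₁ → Σ (Subset n) λ C₂ →
    IsFullComponent G S C₁ × IsFullComponent G S C₂ × C₁ ≢ C₂

IsBlock : ∀ {n} → Graph n → Subset n → Set
IsBlock G C = IsComponentOf G (N G C) C × IsMinimalSeparator G (N G C)

SubCollection : ℕ → Set₁
SubCollection n = Subset n → Set

_[_]ᶜ : ∀ {n} → List (Subset n) → Subset n → SubCollection n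
(𝒲 [ X ]ᶜ) W = W LM.∈ 𝒲 × (∃ λ v → v ∈ W × v ∈ X)

V : ∀ {n} → Graph n → List (Subset n) → SubCollection n → VSet n
V G 𝒲 𝒲' v = ∀ W → W LM.∈ 𝒲 → v ∈ W → 𝒲' W

{-# OPTIONS --safe #-}
-- If v ∉ C lay in V(G, 𝒲[C]), the clique covering v would meet C, so v ∈ N(C).
-- For any full component D of N(C), v has a neighbour d ∈ D; the clique
-- covering the edge dv also meets C, so d ∈ C ∪ N(C), hence d ∈ C as D avoids
-- N(C).  Components of G ∖ N(C) sharing a vertex coincide, so every full
-- component of N(C) equals C, contradicting that N(C) has two of them.
module Submission where

open import Defs
open import Data.Fin using (Fin)
open import Data.Fin.Subset using (Subset; _∈_)
open import Data.Fin.Subset.Properties using (_∈?_; ⊆-antisym)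
open import Data.List using (List)
import Data.List.Membership.Propositional as LM
open import Data.Product using (∃; _×_; _,_; proj₁; proj₂)
open import Data.Sum using (_⊎_; inj₁; inj₂)
open import Relation.Nullary using (yes; no; contradiction)
open import Relation.Binary.PropositionalEquality using (_≡_; _≢_; sym; trans; subst)
open import Function.Bundles using (_⇔_; mk⇔; Equivalence)

module _ {n} (G : Graph n) where

  ReachIn-component : ∀ {S C D d y} →
    IsComponentOf G S C → IsComponentOf G S D →
    d ∈ D → ReachIn G C d y → y ∈ D
  ReachIn-component cC cD d∈D (here _) = d∈D
  ReachIn-component cC@(_ , C∩S≡∅ , _) cD@(_ , _ , _ , D-maximal) d∈D (step r w~y y∈C) =
    D-maximal _ _ (ReachIn-component cC cD d∈D r) (C∩S≡∅ _ y∈C) w~y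

  component-unique : ∀ {S C D d} →
    IsComponentOf G S C → IsComponentOf G S D → d ∈ C → d ∈ D → C ≡ D
  component-unique cC@(_ , _ , C-connected , _) cD@(_ , _ , D-connected , _) d∈C d∈D =
    ⊆-antisym (λ y∈C → ReachIn-component cC cD d∈D (C-connected _ _ d∈C y∈C))
              (λ y∈D → ReachIn-component cD cC d∈C (D-connected _ _ d∈D y∈D))

  clique-meeting-⊆-closedNbhd : ∀ {W X c w} → IsClique G W →
    c ∈ W → c ∈ X → w ∈ W → w ∈ X ⊎ N G X w
  clique-meeting-⊆-closedNbhd {X = X} {c} {w} W-clique c∈W c∈X w∈W with w ∈? X
  ... | yes w∈X = inj₁ w∈X
  ... | no  w∉X = inj₂ (w∉X , c , c∈X , W-clique c w c∈W w∈W c≢w)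
    where
    c≢w : c ≢ w
    c≢w c≡w = w∉X (subst (_∈ X) c≡w c∈X)

  module _ {𝒲 : List (Subset n)} {X : Subset n} {v : Fin n}
           (ecc : IsEdgeCliqueCover G 𝒲)
           (v∈V : V G 𝒲 (𝒲 [ X ]ᶜ) v) where

    V-⊆-closedNbhd-of-clique : ∀ {W w} → W LM.∈ 𝒲 → v ∈ W → w ∈ W → w ∈ X ⊎ N G X w
    V-⊆-closedNbhd-of-clique W∈𝒲 v∈W w∈W with v∈V _ W∈𝒲 v∈W
    ... | _ , c , c∈W , c∈X = clique-meeting-⊆-closedNbhd (proj₁ ecc _ W∈𝒲) c∈W c∈X w∈W

    neighbour-∈-closedNbhd : ∀ {d} → Adj G d v → d ∈ X ⊎ N G X d
    neighbour-∈-closedNbhd d~v with proj₂ ecc _ _ d~v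
    ... | _ , W∈𝒲 , d∈W , v∈W = V-⊆-closedNbhd-of-clique W∈𝒲 v∈W d∈W

    fullComponent-of-N-≡ : IsComponentOf G (N G X) X → N G X v →
      ∀ {D} → IsFullComponent G (N G X) D → D ≡ X
    fullComponent-of-N-≡ X-component v∈NX (D-component@(_ , D∩NX≡∅ , _) , D-full)
      with Equivalence.from (D-full v) v∈NX
    ... | _ , d , d∈D , d~v with neighbour-∈-closedNbhd d~v
    ...   | inj₁ d∈X  = component-unique D-component X-component d∈D d∈X
    ...   | inj₂ d∈NX = contradiction d∈NX (D∩NX≡∅ d d∈D)

lemma15 : ∀ {n} (G : Graph n) (𝒲 : List (Subset n)) →
    IsEdgeCliqueCover G 𝒲 →
    (∀ v → ∃ λ W → W LM.∈ 𝒲 × v ∈ W) →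
    (C : Subset n) → IsBlock G C →
    ∀ v → V G 𝒲 (𝒲 [ C ]ᶜ) v ⇔ v ∈ C
lemma15 G 𝒲 ecc covered C (C-component , C₁ , C₂ , C₁-full , C₂-full , C₁≢C₂) v =
  mk⇔ V⇒∈ (λ v∈C W W∈𝒲 v∈W → W∈𝒲 , v , v∈W , v∈C)
  where
  V⇒∈ : V G 𝒲 (𝒲 [ C ]ᶜ) v → v ∈ C
  V⇒∈ v∈V with covered v
  ... | _ , W∈𝒲 , v∈W with V-⊆-closedNbhd-of-clique G ecc v∈V W∈𝒲 v∈W v∈W
  ...   | inj₁ v∈C  = v∈C
  ...   | inj₂ v∈NC = contradiction (trans (≡C C₁-full) (sym (≡C C₂-full))) C₁≢C₂
    where
    ≡C : ∀ {D} → IsFullComponent G (N G C) D → D ≡ C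
    ≡C = fullComponent-of-N-≡ G ecc v∈V C-component v∈NC
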